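{- Let $p,p'$ be coprime with $1\le p<p'$, let $p'/p$ have continued fraction $[c_0,c_1,\ldots,c_n]$, let $0\le \ell<2c_n-1$, and set $\hat p'=\xi_{\ell+1}-\xi_\ell$ and $\hat p=\tilde\xi_{\ell+1}-\tilde\xi_\ell$. (1) $\hat p'\ge2$ if and only if one of the following holds: (i) $\ell$ is odd, $n\ge2$, and if $n=2$ then $c_0>1$; in this case $\hat p'/\hat p$ has continued fraction $[c_0,c_1,\ldots,c_{n-2}]$. (ii) $\ell\in\{0,2c_n-2\}$, $n\ge1$, and if $n=1$ then $c_0>1$; in this case $\hat p'/\hat p$ has continued fraction $[c_0,c_1,\ldots,c_{n-1}]$. (iii) $\ell$ is even, $0<\ell<2c_n-2$, $c_{n-1}>1$, $n\ge1$, and if $n=1$ then $c_0>2$; in this case $\hat p'/\hat p$ has continued fraction $[c_0,c_1,\ldots,c_{n-1}-1]$. (iv) $\ell$ is even, $0<\ell<2c_n-2$, $c_{n-1}=1$, $n\ge3$, and if $n=3$ then $c_0>1$; in this case $\hat p'/\hat p$ has continued fraction $[c_0,c_1,\ldots,c_{n-3}]$. (2) Suppose $\hat p'\ge2$. Let $\{\kappa_i\}_{i=0}^t$ and $\{\tilde\kappa_i\}_{i=0}^t$ be the Takahashi lengths and truncated Takahashi lengths of $p'/p$, and let $\{\kappa'_i\}_{i=0}^{t'}$ and $\{\tilde\kappa'_i\}_{i=0}^{t'}$ be those of $\hat p'/\hat p$ (with $t'$ its rank). Then $\kappa'_i=\kappa_i$ and $\tilde\kappa'_i=\tilde\kappa_i$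 for $0\le i\le t'$.
   Context: For coprime $1\le q<q'$, the continued fraction $[c_0,\ldots,c_n]$ of $q'/q$ has $c_i\ge1$ ($i<n$), $c_n\ge2$, $q'/q=c_0+1/(c_1+1/(\cdots+1/c_n))$; a continued fraction $[d_0,\ldots,d_m]$ with $m>0$ and $d_m=1$ is identified with $[d_0,\ldots,d_{m-1}+1]$. Set $t_k=-1+\sum_{i=0}^{k-1}c_i$ ($0\le k\le n+1$) and rank $t=t_{n+1}-1$. Define $y_{ -1}=0,y_0=1$, $z_{ -1}=1,z_0=0$, $y_k=c_{k-1}y_{k-1}+y_{k-2}$, $z_k=c_{k-1}z_{k-1}+z_{k-2}$ for $1\le k\le n+1$. For $0\le k\le n$ and $t_k<j\le t_{k+1}$ the Takahashi lengths are $\kappa_j=y_{k-1}+(j-t_k)y_k$ and the truncated Takahashi lengths are $\tilde\kappa_j=z_{k-1}+(j-t_k)z_k$. For $p'/p$, define $\xi_0=\tilde\xi_0=0$, $\xi_{2c_n-1}=p'$, $\tilde\xi_{2c_n-1}=p$, and for $1\le k<c_n$: $\xi_{2k-1}=ky_n$, $\xi_{2k}=ky_n+y_{n-1}$, $\tilde\xi_{2k-1}=kz_n$, $\tilde\xi_{2k}=kz_n+z_{n-1}$. -}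

module Defs where

open import Data.Nat using (ℕ; zero; suc; _+_; _*_; _∸_; _≤_; _<_; _≟_)
open import Data.List using (List; map; concatMap; upTo)
open import Data.Product using (_×_)
open import Data.Bool using (if_then_else_)
open import Relation.Nullary using (does)
open import Relation.Binary.PropositionalEquality using (_≡_)

-- A continued fraction [c_0,...,c_n] is represented by its length index n
-- together with a sequence c : ℕ → ℕ (only c 0, ..., c n are relevant).

-- Shifted convergent recurrence: convₛ a b c k = w_{k-1}, where
-- w_{-1} = a, w_0 = b, w_k = c_{k-1} w_{k-1} + w_{k-2}.
convₛ : ℕ → ℕ → (ℕ → ℕ) → ℕ → ℕ
convₛ a b c zero = a
convₛ a b c (suc zero) = b
convₛ a b c (suc (suc k)) = c k * convₛ a b c (suc k) + convₛ a b c k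

-- Yₛ c k = y_{k-1}   (y_{-1} = 0, y_0 = 1)
Yₛ : (ℕ → ℕ) → ℕ → ℕ
Yₛ = convₛ 0 1

-- Zₛ c k = z_{k-1}   (z_{-1} = 1, z_0 = 0)
Zₛ : (ℕ → ℕ) → ℕ → ℕ
Zₛ = convₛ 1 0

y : (ℕ → ℕ) → ℕ → ℕ
y c k = Yₛ c (suc k)

z : (ℕ → ℕ) → ℕ → ℕ
z c k = Zₛ c (suc k)

-- The continued fraction [c_0,...,c_n] (entries ≥ 1, not necessarily
-- canonical, i.e. the last entry may be 1) represents q'/q, in lowest terms:
-- q' = y_{n+1}, q = z_{n+1}.  (y_{n+1}, z_{n+1} are always coprime.)
HasValue : ℕ → ℕ → ℕ → (ℕ → ℕ) → Set
HasValue q' q n c = y c (suc n) ≡ q' × z c (suc n) ≡ q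

Canonical : ℕ → (ℕ → ℕ) → Set
Canonical n c = (∀ i → i < n → 1 ≤ c i) × 2 ≤ c n

IsCF : ℕ → ℕ → ℕ → (ℕ → ℕ) → Set
IsCF q' q n c = Canonical n c × HasValue q' q n c

-- T c k = c_0 + ... + c_{k-1} = t_k + 1
T : (ℕ → ℕ) → ℕ → ℕ
T c zero = 0
T c (suc k) = T c k + c k

-- rank t = t_{n+1} - 1 = T c (n+1) - 2
rank : ℕ → (ℕ → ℕ) → ℕ
rank n c = T c (suc n) ∸ 2

-- The list of lengths [ w_{k-1} + s w_k | k = 0..n, s = 1..c_k ],
-- whose entry at position j (t_k < j ≤ t_{k+1}, s = j - t_k) is
-- w_{k-1} + (j - t_k) w_k.
lengthsGen : ((ℕ → ℕ) → ℕ → ℕ) → ℕ → (ℕ → ℕ) → List ℕ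
lengthsGen W n c =
  concatMap (λ k → map (λ s → W c k + s * W c (suc k)) (map suc (upTo (c k))))
            (upTo (suc n))

takahashi : ℕ → (ℕ → ℕ) → List ℕ
takahashi = lengthsGen Yₛ

truncTakahashi : ℕ → (ℕ → ℕ) → List ℕ
truncTakahashi = lengthsGen Zₛ

-- ξ-helper for 0 ≤ i < 2 c_n - 1 with a = w_n, b = w_{n-1}:
-- index 0 ↦ 0, index 2k-1 ↦ k a, index 2k ↦ k a + b   (k ≥ 1)
xiAux : ℕ → ℕ → ℕ → ℕ
xiAux a b zero = 0
xiAux a b (suc zero) = a
xiAux a b (suc (suc zero)) = a + b
xiAux a b (suc (suc (suc i))) = a + xiAux a b (suc i)

ξ : ℕ → (ℕ → ℕ) → ℕ → ℕ → ℕ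
ξ n c p' i = if does (i ≟ 2 * c n ∸ 1) then p' else xiAux (y c n) (Yₛ c n) i

ξ~ : ℕ → (ℕ → ℕ) → ℕ → ℕ → ℕ
ξ~ n c p i = if does (i ≟ 2 * c n ∸ 1) then p else xiAux (z c n) (Zₛ c n) i

decAt : ℕ → (ℕ → ℕ) → ℕ → ℕ
decAt m c i = if does (i ≟ m) then c i ∸ 1 else c i

{-# OPTIONS --safe #-}
module Submission where

-- The increments ξ_{ℓ+1} − ξ_ℓ are y_{n−1} for odd ℓ, y_n at the ends ℓ = 0 and
-- ℓ = 2c_n − 2, and y_n − y_{n−1} for even interior ℓ (likewise for ξ~ with z).
-- Each is the value of a truncation of [c_0,…,c_n]: [c_0,…,c_{n−2}], [c_0,…,c_{n−1}]
-- and [c_0,…,c_{n−1} − 1], the last one collapsing to [c_0,…,c_{n−3}] when c_{n−1} = 1;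
-- its numerator is ≥ 2 exactly under the stated conditions.  A truncation may end in
-- 1, so by uniqueness of Euclidean division the canonical expansion of p̂'/p̂ agrees
-- with it except that its last entry may be one larger.  The first t' + 1 Takahashi
-- lengths only involve these entries, hence coincide with those of p'/p.

open import Defs
open import Data.Bool using (if_then_else_)
open import Data.List using (List; []; _∷_; _++_; map; concatMap; upTo; applyUpTo; take; length)
open import Data.List.Properties
  using ( ++-assoc; ++-identityʳ; concatMap-++; upTo-∷ʳ; length-++; length-applyUpTo
        ; map-upTo; map-applyUpTo )
open import Data.Nat
  using ( ℕ; zero; suc; _+_; _*_; _∸_; _≤_; _<_; _>_; _%_; _≟_; z≤n; s≤s; z<s; s<s; s≤s⁻¹
        ; _≤′_; ≤′-refl; ≤′-step; >-nonZero )
open import Data.Nat.Coprimality using (Coprime)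
open import Data.Nat.DivMod using (m*n%n≡0; [m+kn]%n≡m%n)
open import Data.Nat.Properties
open import Data.Nat.Tactic.RingSolver using (solve-∀)
open import Data.Product using (_×_; _,_; proj₁; proj₂; map₁; ∃-syntax)
open import Data.Sum using (_⊎_; inj₁; inj₂; [_,_]) renaming (map to ⊎-map; map₂ to ⊎-map₂)
open import Function using (_∘_; id)
open import Function.Bundles using (_⇔_; mk⇔; Equivalence)
open import Function.Properties.Equivalence using () renaming (trans to ⇔-trans)
open import Relation.Nullary using (does; contradiction)
open import Relation.Nullary.Decidable using (dec-true; dec-false)
open import Relation.Binary.PropositionalEquality
  using (_≡_; _≢_; refl; sym; trans; cong; cong₂; subst; subst₂; module ≡-Reasoning)

-- Continuants

shift : (ℕ → ℕ) → ℕ → ℕ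
shift c i = c (suc i)

Positive : ℕ → (ℕ → ℕ) → Set
Positive k c = ∀ i → i < k → 1 ≤ c i

Positive-≤ : ∀ {j k c} → j ≤ k → Positive k c → Positive j c
Positive-≤ j≤k pos i i<j = pos i (<-≤-trans i<j j≤k)

Positive-shift : ∀ {k c} → Positive (suc k) c → Positive k (shift c)
Positive-shift pos i i<k = pos (suc i) (s≤s i<k)

canonical⇒positive : ∀ {k c} → Canonical k c → Positive (suc k) c
canonical⇒positive (pos , 2≤cₖ) i i≤k with m≤n⇒m<n∨m≡n (s≤s⁻¹ i≤k)
... | inj₁ i<k  = pos i i<k
... | inj₂ refl = <⇒≤ 2≤cₖ

canonical-shift : ∀ {k c} → Canonical (suc k) c → Canonical k (shift c)
canonical-shift (pos , 2≤cₖ) = Positive-shift pos , 2≤cₖ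

convₛ-cong : ∀ a b {c c′ : ℕ → ℕ} k → (∀ j → j < k → c j ≡ c′ j) →
             ∀ i → i ≤ suc k → convₛ a b c i ≡ convₛ a b c′ i
convₛ-cong a b k agree zero          _         = refl
convₛ-cong a b k agree (suc zero)    _         = refl
convₛ-cong a b k agree (suc (suc i)) (s≤s i<k) =
  cong₂ _+_ (cong₂ _*_ (agree i i<k) (convₛ-cong a b k agree (suc i) (m≤n⇒m≤1+n i<k)))
            (convₛ-cong a b k agree i (<⇒≤ (m<n⇒m<1+n i<k)))

Yₛ-shift : ∀ c k → Yₛ c (suc k) ≡ c 0 * Yₛ (shift c) k + Zₛ (shift c) k
Yₛ-shift c zero          = cong (_+ 1) (sym (*-zeroʳ (c 0)))
Yₛ-shift c (suc zero)    = refl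
Yₛ-shift c (suc (suc k)) = begin
    c (suc k) * Yₛ c (suc (suc k)) + Yₛ c (suc k)
  ≡⟨ cong₂ (λ u v → c (suc k) * u + v) (Yₛ-shift c (suc k)) (Yₛ-shift c k) ⟩
    c (suc k) * (c 0 * Yₛ c′ (suc k) + Zₛ c′ (suc k)) + (c 0 * Yₛ c′ k + Zₛ c′ k)
  ≡⟨ regroup (c (suc k)) (c 0) _ _ _ _ ⟩
    c 0 * Yₛ c′ (suc (suc k)) + Zₛ c′ (suc (suc k))
  ∎
  where
  open ≡-Reasoning
  c′ : ℕ → ℕ
  c′ = shift c
  regroup : ∀ x c₀ u v u′ v′ →
            x * (c₀ * u + v) + (c₀ * u′ + v′) ≡ c₀ * (x * u + u′) + (x * v + v′)
  regroup = solve-∀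

Zₛ-shift : ∀ c k → Zₛ c (suc k) ≡ Yₛ (shift c) k
Zₛ-shift c zero          = refl
Zₛ-shift c (suc zero)    = cong (_+ 1) (*-zeroʳ (c 0))
Zₛ-shift c (suc (suc k)) =
  cong₂ (λ u v → c (suc k) * u + v) (Zₛ-shift c (suc k)) (Zₛ-shift c k)

y₁≡c₀ : ∀ c → y c 1 ≡ c 0
y₁≡c₀ c = trans (+-identityʳ (c 0 * 1)) (*-identityʳ (c 0))

z₁≡1 : ∀ c → z c 1 ≡ 1
z₁≡1 c = cong (_+ 1) (*-zeroʳ (c 0))

y+Yₛ≤y : ∀ c k → 1 ≤ c k → y c k + Yₛ c k ≤ y c (suc k)
y+Yₛ≤y c k 1≤cₖ = +-monoˡ-≤ (Yₛ c k) (m≤n*m (y c k) (c k) {{>-nonZero 1≤cₖ}})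

1≤y : ∀ {k c} → Positive k c → 1 ≤ y c k
1≤y {zero}      _   = s≤s z≤n
1≤y {suc k} {c} pos = ≤-trans (1≤y (Positive-≤ (n≤1+n k) pos))
                              (≤-trans (m≤m+n (y c k) (Yₛ c k)) (y+Yₛ≤y c k (pos k (n<1+n k))))

2≤y : ∀ {j c} → Positive (suc (suc j)) c → 2 ≤ y c (suc (suc j))
2≤y {j} {c} pos =
  ≤-trans (+-mono-≤ (1≤y (Positive-≤ (n≤1+n (suc j)) pos)) (1≤y (Positive-≤ (m≤n+m j 2) pos)))
          (y+Yₛ≤y c (suc j) (pos (suc j) (n<1+n (suc j))))

1≤z : ∀ {k c} → Positive (suc k) c → 1 ≤ z c (suc k)
1≤z {k} {c} pos = subst (1 ≤_) (sym (Zₛ-shift c (suc k))) (1≤y (Positive-shift pos))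

2≤y-canonical : ∀ {k c} → Canonical k c → 2 ≤ y c (suc k)
2≤y-canonical {zero}  {c} (_ , 2≤c₀) = subst (2 ≤_) (sym (y₁≡c₀ c)) 2≤c₀
2≤y-canonical {suc j}     can        = 2≤y (canonical⇒positive can)

z≤y : ∀ {c} → 1 ≤ c 0 → ∀ k → z c k ≤ y c k
z≤y     _    zero          = z≤n
z≤y {c} 1≤c₀ (suc zero)    = subst₂ _≤_ (sym (z₁≡1 c)) (sym (y₁≡c₀ c)) 1≤c₀
z≤y {c} 1≤c₀ (suc (suc k)) =
  +-mono-≤ (*-monoʳ-≤ (c (suc k)) (z≤y 1≤c₀ (suc k))) (z≤y 1≤c₀ k)

z<y : ∀ {k c} → Canonical k c → z c (suc k) < y c (suc k)
z<y {zero}  {c} (_ , 2≤c₀) = subst₂ _<_ (sym (z₁≡1 c)) (sym (y₁≡c₀ c)) 2≤c₀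
z<y {suc k} {c} can        = begin-strict
    z c (suc (suc k))                  ≡⟨ Zₛ-shift c (suc (suc k)) ⟩
    y c′ (suc k)                       <⟨ m<m+n (y c′ (suc k)) (1≤z (Positive-shift pos)) ⟩
    y c′ (suc k) + z c′ (suc k)        ≤⟨ +-monoˡ-≤ (z c′ (suc k)) y′≤c₀y′ ⟩
    c 0 * y c′ (suc k) + z c′ (suc k)  ≡⟨ sym (Yₛ-shift c (suc (suc k))) ⟩
    y c (suc (suc k))                  ∎
  where
  open ≤-Reasoning
  c′ : ℕ → ℕ
  c′ = shift c
  pos : Positive (suc (suc k)) c
  pos = canonical⇒positive can
  y′≤c₀y′ : y c′ (suc k) ≤ c 0 * y c′ (suc k)
  y′≤c₀y′ = m≤n*m (y c′ (suc k)) (c 0) {{>-nonZero (pos 0 z<s)}}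

-- Decreasing one entry

if-≟-≡ : ∀ {A : Set} {i j : ℕ} (u v : A) → i ≡ j → (if does (i ≟ j) then u else v) ≡ u
if-≟-≡ {i = i} {j} u v i≡j = cong (if_then u else v) (dec-true (i ≟ j) i≡j)

if-≟-≢ : ∀ {A : Set} {i j : ℕ} (u v : A) → i ≢ j → (if does (i ≟ j) then u else v) ≡ v
if-≟-≢ {i = i} {j} u v i≢j = cong (if_then u else v) (dec-false (i ≟ j) i≢j)

decAt-same : ∀ m c → decAt m c m ≡ c m ∸ 1
decAt-same m c = if-≟-≡ {i = m} {m} (c m ∸ 1) (c m) refl

decAt-other : ∀ m c {i} → i ≢ m → decAt m c i ≡ c i
decAt-other m c {i} = if-≟-≢ {i = i} {m} (c i ∸ 1) (c i)

Positive-decAt : ∀ {m c} → Positive m c → 1 < c m → Positive (suc m) (decAt m c)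
Positive-decAt {m} {c} pos 1<cₘ i i≤m with m≤n⇒m<n∨m≡n (s≤s⁻¹ i≤m)
... | inj₁ i<m  = subst (1 ≤_) (sym (decAt-other m c (<⇒≢ i<m))) (pos i i<m)
... | inj₂ refl = subst (1 ≤_) (sym (decAt-same m c)) (∸-monoˡ-≤ 1 1<cₘ)

[m*n+o]∸n≡[m∸1]*n+o : ∀ m n o → 1 ≤ m → m * n + o ∸ n ≡ (m ∸ 1) * n + o
[m*n+o]∸n≡[m∸1]*n+o (suc m) n o _ =
  trans (cong (_∸ n) (+-assoc n (m * n) o)) (m+n∸m≡n n (m * n + o))

convₛ-decAt : ∀ a b c m → 1 ≤ c m →
              convₛ a b (decAt m c) (suc (suc m))
                ≡ convₛ a b c (suc (suc m)) ∸ convₛ a b c (suc m)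
convₛ-decAt a b c m 1≤cₘ = begin
    decAt m c m * convₛ a b (decAt m c) (suc m) + convₛ a b (decAt m c) m
  ≡⟨ cong₂ _+_ (cong₂ _*_ (decAt-same m c) (below (suc m) ≤-refl)) (below m (n≤1+n m)) ⟩
    (c m ∸ 1) * convₛ a b c (suc m) + convₛ a b c m
  ≡⟨ sym ([m*n+o]∸n≡[m∸1]*n+o (c m) _ _ 1≤cₘ) ⟩
    convₛ a b c (suc (suc m)) ∸ convₛ a b c (suc m)
  ∎
  where
  open ≡-Reasoning
  below : ∀ i → i ≤ suc m → convₛ a b (decAt m c) i ≡ convₛ a b c i
  below = convₛ-cong a b m (λ j j<m → decAt-other m c (<⇒≢ j<m))

convₛ-step-unit : ∀ a b c k → c k ≡ 1 →
                  convₛ a b c (suc (suc k)) ∸ convₛ a b c (suc k) ≡ convₛ a b c k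
convₛ-step-unit a b c k cₖ≡1 =
  trans ([m*n+o]∸n≡[m∸1]*n+o (c k) _ _ (≤-reflexive (sym cₖ≡1)))
        (cong (λ x → (x ∸ 1) * convₛ a b c (suc k) + convₛ a b c k) cₖ≡1)

-- Numerators at least 2

Cond₁ Cond₂ Cond₃ Cond₄ : ℕ → (ℕ → ℕ) → Set
Cond₁ n c = 2 ≤ n × (n ≡ 2 → c 0 > 1)
Cond₂ n c = 1 ≤ n × (n ≡ 1 → c 0 > 1)
Cond₃ n c = c (n ∸ 1) > 1 × 1 ≤ n × (n ≡ 1 → c 0 > 2)
Cond₄ n c = c (n ∸ 1) ≡ 1 × 3 ≤ n × (n ≡ 3 → c 0 > 1)

suc-bound⇔ : ∀ {j m} {A : Set} →
             (suc j ≤ suc m × (suc m ≡ suc j → A)) ⇔ (j ≤ m × (m ≡ j → A))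
suc-bound⇔ = mk⇔ (λ (j<m , f) → s≤s⁻¹ j<m , f ∘ cong suc)
                 (λ (j≤m , f) → s≤s j≤m , f ∘ suc-injective)

2≤Yₛ⇔Cond₁ : ∀ {k c} → Positive (k ∸ 1) c → 2 ≤ Yₛ c k ⇔ Cond₁ k c
2≤Yₛ⇔Cond₁ {zero}                  _   = mk⇔ (λ ()) (λ { (() , _) })
2≤Yₛ⇔Cond₁ {suc zero}              _   = mk⇔ (λ { (s≤s ()) }) (λ { (s≤s () , _) })
2≤Yₛ⇔Cond₁ {suc (suc zero)}    {c} _   =
  mk⇔ (λ 2≤y₁ → s≤s (s≤s z≤n) , λ _ → subst (2 ≤_) (y₁≡c₀ c) 2≤y₁)
      (λ (_ , c₀>1) → subst (2 ≤_) (sym (y₁≡c₀ c)) (c₀>1 refl))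
2≤Yₛ⇔Cond₁ {suc (suc (suc j))}     pos =
  mk⇔ (λ _ → s≤s (s≤s z≤n) , λ ()) (λ _ → 2≤y pos)

2≤y⇔Cond₂ : ∀ {n c} → Positive n c → 2 ≤ y c n ⇔ Cond₂ n c
2≤y⇔Cond₂ {n} pos = ⇔-trans (2≤Yₛ⇔Cond₁ {suc n} pos) suc-bound⇔

2≤y∸Yₛ⇔Cond₃ : ∀ {m c} → Positive m c → 1 < c m →
               2 ≤ y c (suc m) ∸ Yₛ c (suc m) ⇔ Cond₃ (suc m) c
2≤y∸Yₛ⇔Cond₃ {zero} {c} _ 1<c₀ =
  mk⇔ (λ h → 1<c₀ , s≤s z≤n , λ _ → m≤o∸n⇒m+n≤o 2 (<⇒≤ 1<c₀) (subst (λ t → 2 ≤ t ∸ 1) y₁≡ h))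
      (λ (_ , _ , c₀>2) → subst (λ t → 2 ≤ t ∸ 1) (sym y₁≡) (∸-monoˡ-≤ 1 (c₀>2 refl)))
  where
  y₁≡ : y c 1 ≡ c 0
  y₁≡ = y₁≡c₀ c
2≤y∸Yₛ⇔Cond₃ {suc j} {c} pos 1<cₘ =
  mk⇔ (λ _ → 1<cₘ , s≤s z≤n , λ ())
      (λ _ → subst (2 ≤_) (convₛ-decAt 0 1 c (suc j) (<⇒≤ 1<cₘ)) (2≤y (Positive-decAt pos 1<cₘ)))

2≤y∸Yₛ⇔Cond₄ : ∀ {m c} → Positive m c → c m ≡ 1 →
               2 ≤ y c (suc m) ∸ Yₛ c (suc m) ⇔ Cond₄ (suc m) c
2≤y∸Yₛ⇔Cond₄ {m} {c} pos cₘ≡1 =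
  mk⇔ (λ h → cₘ≡1 , from suc-bound⇔ (to Cond₁⇔ (subst (2 ≤_) step h)))
      (λ (_ , h) → subst (2 ≤_) (sym step) (from Cond₁⇔ (to suc-bound⇔ h)))
  where
  open Equivalence
  step : y c (suc m) ∸ Yₛ c (suc m) ≡ Yₛ c m
  step = convₛ-step-unit 0 1 c m cₘ≡1
  Cond₁⇔ : 2 ≤ Yₛ c m ⇔ Cond₁ m c
  Cond₁⇔ = 2≤Yₛ⇔Cond₁ (Positive-≤ (m∸n≤m m 1) pos)

2≤y∸Yₛ⇔Cond₃⊎Cond₄ : ∀ {n c} → Positive n c → 2 ≤ y c n ∸ Yₛ c n ⇔ (Cond₃ n c ⊎ Cond₄ n c)
2≤y∸Yₛ⇔Cond₃⊎Cond₄ {zero} _ =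
  mk⇔ (λ { (s≤s ()) }) [ (λ { (_ , () , _) }) , (λ { (_ , () , _) }) ]
2≤y∸Yₛ⇔Cond₃⊎Cond₄ {suc m} pos with m≤n⇒m<n∨m≡n (pos m (n<1+n m))
... | inj₁ 1<cₘ =
  ⇔-trans (2≤y∸Yₛ⇔Cond₃ (Positive-≤ (n≤1+n m) pos) 1<cₘ)
          (mk⇔ inj₁ [ id , (λ (cₘ≡1 , _) → contradiction (sym cₘ≡1) (<⇒≢ 1<cₘ)) ])
... | inj₂ 1≡cₘ =
  ⇔-trans (2≤y∸Yₛ⇔Cond₄ (Positive-≤ (n≤1+n m) pos) (sym 1≡cₘ))
          (mk⇔ inj₂ [ (λ (1<cₘ , _) → contradiction 1≡cₘ (<⇒≢ 1<cₘ)) , id ])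

-- Uniqueness of canonical expansions

record Truncation (slack n′ : ℕ) (c′ : ℕ → ℕ) (n : ℕ) (c : ℕ → ℕ) : Set where
  field
    length≤ : n′ ≤ n
    agree   : ∀ i → i < n′ → c′ i ≡ c i
    last≤   : c′ n′ ≤ slack + c n′

truncation-refl : ∀ {m n c} → m ≤ n → Truncation 0 m c n c
truncation-refl m≤n = record { length≤ = m≤n ; agree = λ _ _ → refl ; last≤ = ≤-refl }

truncation-decAt : ∀ {m n c} → m ≤ n → Truncation 0 m (decAt m c) n c
truncation-decAt {m} {c = c} m≤n = record
  { length≤ = m≤n
  ; agree   = λ i i<m → decAt-other m c (<⇒≢ i<m)
  ; last≤   = subst (_≤ c m) (sym (decAt-same m c)) (m∸n≤m (c m) 1)
  }

truncation-trans : ∀ {s t n₁ c₁ n₂ c₂ n₃ c₃} → Truncation s n₁ c₁ n₂ c₂ →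
                   Truncation t n₂ c₂ n₃ c₃ → Truncation (s + t) n₁ c₁ n₃ c₃
truncation-trans {s} {t} {n₁} {c₁} {n₂} {c₂} {n₃} {c₃} tr₁ tr₂ = record
  { length≤ = ≤-trans (length≤ tr₁) (length≤ tr₂)
  ; agree   = λ i i<n₁ → trans (agree tr₁ i i<n₁) (agree tr₂ i (<-≤-trans i<n₁ (length≤ tr₁)))
  ; last≤   = ≤-trans (last≤ tr₁)
                      (≤-trans (+-monoʳ-≤ s c₂≤) (≤-reflexive (sym (+-assoc s t (c₃ n₁)))))
  }
  where
  open Truncation
  c₂≤ : c₂ n₁ ≤ t + c₃ n₁
  c₂≤ with m≤n⇒m<n∨m≡n (length≤ tr₁)
  ... | inj₁ n₁<n₂ = ≤-trans (≤-reflexive (agree tr₂ n₁ n₁<n₂)) (m≤n+m (c₃ n₁) t)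
  ... | inj₂ refl  = last≤ tr₂

-- r = Q is allowed because a non-canonical expansion may end in 1.
quotient-unique : ∀ {a b Q r s} → r ≤ Q → s < Q → 1 ≤ s →
                  a * Q + r ≡ b * Q + s → a ≡ b × r ≡ s
quotient-unique {zero}  {zero}              _   _   _   eq = refl , eq
quotient-unique {zero}  {suc b} {Q} {r} {s} r≤Q _   1≤s eq =
  contradiction (subst (_≤ Q) eq r≤Q) (<⇒≱ Q<)
  where
  Q< : Q < suc b * Q + s
  Q< = subst (Q <_) (sym (+-assoc Q (b * Q) s)) (m<m+n Q (≤-trans 1≤s (m≤n+m s (b * Q))))
quotient-unique {suc a} {zero}  {Q} {r}     _   s<Q _   eq =
  contradiction (subst (Q ≤_) eq (≤-trans (m≤m+n Q (a * Q)) (m≤m+n (suc a * Q) r))) (<⇒≱ s<Q)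
quotient-unique {suc a} {suc b} {Q} {r} {s} r≤Q s<Q 1≤s eq =
  map₁ (cong suc) (quotient-unique r≤Q s<Q 1≤s
    (+-cancelˡ-≡ Q _ _ (trans (sym (+-assoc Q (a * Q) r)) (trans eq (+-assoc Q (b * Q) s)))))

HasValue-peel : ∀ {q′ q} m e → HasValue q′ q (suc m) e →
                q′ ≡ e 0 * q + z (shift e) (suc m) × HasValue q (z (shift e) (suc m)) m (shift e)
HasValue-peel {q′} {q} m e (e-y , e-z) =
  trans (sym e-y) (trans (Yₛ-shift e (suc (suc m))) (cong (λ t → e 0 * t + z (shift e) (suc m)) y′≡q)) ,
  y′≡q , refl
  where
  y′≡q : y (shift e) (suc m) ≡ q
  y′≡q = trans (sym (Zₛ-shift e (suc (suc m)))) e-z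

denominator≤numerator : ∀ {q′ q} m e → 1 ≤ e 0 → HasValue q′ q m e → q ≤ q′
denominator≤numerator m e 1≤e₀ (e-y , e-z) = subst₂ _≤_ e-z e-y (z≤y 1≤e₀ (suc m))

denominator<numerator : ∀ {q′ q} n c → Canonical n c → HasValue q′ q n c → q < q′
denominator<numerator n c can (c-y , c-z) = subst₂ _<_ c-z c-y (z<y can)

canonical⇒truncation : ∀ {q′ q} m n′ {e c′} → Positive (suc m) e → Canonical n′ c′ →
                        HasValue q′ q m e → HasValue q′ q n′ c′ → Truncation 1 n′ c′ m e
canonical⇒truncation zero zero {e} {c′} _ _ (e-y , _) (c′-y , _) = record
  { length≤ = z≤n
  ; agree   = λ _ ()
  ; last≤   = ≤-trans (≤-reflexive c′₀≡e₀) (n≤1+n (e 0))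
  }
  where
  c′₀≡e₀ : c′ 0 ≡ e 0
  c′₀≡e₀ = trans (sym (y₁≡c₀ c′)) (trans c′-y (trans (sym e-y) (y₁≡c₀ e)))
canonical⇒truncation zero (suc n″) {e} {c′} _ can′ (_ , e-z) (_ , c′-z) =
  contradiction (subst (2 ≤_) (trans c′-z (trans (sym e-z) (z₁≡1 e))) 2≤z′) λ { (s≤s ()) }
  where
  2≤z′ : 2 ≤ z c′ (suc (suc n″))
  2≤z′ = subst (2 ≤_) (sym (Zₛ-shift c′ (suc (suc n″)))) (2≤y-canonical (canonical-shift can′))
canonical⇒truncation {q′} {q} (suc m) zero {e} {c′} pos _ e-val (c′-y , c′-z) = record
  { length≤ = z≤n
  ; agree   = λ _ ()
  ; last≤   = c′₀≤1+e₀
  }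
  where
  open ≤-Reasoning
  r : ℕ
  r = z (shift e) (suc m)
  peeled : q′ ≡ e 0 * q + r × HasValue q r m (shift e)
  peeled = HasValue-peel m e e-val
  q≡1 : q ≡ 1
  q≡1 = trans (sym c′-z) (z₁≡1 c′)
  r≤1 : r ≤ 1
  r≤1 = subst (r ≤_) q≡1 (denominator≤numerator m (shift e) (pos 1 (s≤s (s≤s z≤n))) (proj₂ peeled))
  c′₀≤1+e₀ : c′ 0 ≤ 1 + e 0
  c′₀≤1+e₀ = begin
    c′ 0         ≡⟨ trans (sym (y₁≡c₀ c′)) (trans c′-y (proj₁ peeled)) ⟩
    e 0 * q + r  ≡⟨ cong (λ t → e 0 * t + r) q≡1 ⟩
    e 0 * 1 + r  ≤⟨ +-mono-≤ (≤-reflexive (*-identityʳ (e 0))) r≤1 ⟩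
    e 0 + 1      ≡⟨ +-comm (e 0) 1 ⟩
    1 + e 0      ∎
canonical⇒truncation {q′} {q} (suc m) (suc n″) {e} {c′} pos can′ e-val c′-val = record
  { length≤ = s≤s (length≤ tr)
  ; agree   = agree′
  ; last≤   = last≤ tr
  }
  where
  open Truncation
  r s : ℕ
  r = z (shift e) (suc m)
  s = z (shift c′) (suc n″)
  e-peeled : q′ ≡ e 0 * q + r × HasValue q r m (shift e)
  e-peeled = HasValue-peel m e e-val
  c′-peeled : q′ ≡ c′ 0 * q + s × HasValue q s n″ (shift c′)
  c′-peeled = HasValue-peel n″ c′ c′-val
  division : e 0 ≡ c′ 0 × r ≡ s
  division = quotient-unique
    (denominator≤numerator m (shift e) (pos 1 (s≤s (s≤s z≤n))) (proj₂ e-peeled))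
    (denominator<numerator n″ (shift c′) (canonical-shift can′) (proj₂ c′-peeled))
    (1≤z (canonical⇒positive (canonical-shift can′)))
    (trans (sym (proj₁ e-peeled)) (proj₁ c′-peeled))
  tr : Truncation 1 n″ (shift c′) m (shift e)
  tr = canonical⇒truncation m n″ (Positive-shift pos) (canonical-shift can′) (proj₂ e-peeled)
         (proj₁ (proj₂ c′-peeled) , trans (proj₂ (proj₂ c′-peeled)) (sym (proj₂ division)))
  agree′ : ∀ i → i < suc n″ → c′ i ≡ e i
  agree′ zero    _          = sym (proj₁ division)
  agree′ (suc i) (s≤s i<n″) = agree tr i i<n″

-- Prefixes of the length lists

take-applyUpTo : ∀ {A : Set} (f : ℕ → A) {x m} → x ≤ m → take x (applyUpTo f m) ≡ applyUpTo f x
take-applyUpTo f z≤n       = refl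
take-applyUpTo f (s≤s x≤m) = cong (f 0 ∷_) (take-applyUpTo (f ∘ suc) x≤m)

take-length-++ : ∀ {A : Set} (xs ys : List A) n → take (length xs + n) (xs ++ ys) ≡ xs ++ take n ys
take-length-++ []       ys n = refl
take-length-++ (x ∷ xs) ys n = cong (x ∷_) (take-length-++ xs ys n)

take-++-≤ : ∀ {A : Set} (xs ys : List A) {n} → n ≤ length xs → take n (xs ++ ys) ≡ take n xs
take-++-≤ xs       ys {zero}  _  = refl
take-++-≤ (x ∷ xs) ys {suc n} n≤ = cong (x ∷_) (take-++-≤ xs ys (s≤s⁻¹ n≤))

progression : ℕ → ℕ → ℕ → List ℕ
progression u v m = applyUpTo (λ s → u + suc s * v) m

-- lengthsGen W n c is blocks W c (suc n) by definition.
block blocks : ((ℕ → ℕ) → ℕ → ℕ) → (ℕ → ℕ) → ℕ → List ℕ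
block  W c k = map (λ s → W c k + s * W c (suc k)) (map suc (upTo (c k)))
blocks W c k = concatMap (block W c) (upTo k)

block≡progression : ∀ W c k → block W c k ≡ progression (W c k) (W c (suc k)) (c k)
block≡progression W c k =
  trans (cong (map (λ s → W c k + s * W c (suc k))) (map-upTo suc (c k))) (map-applyUpTo suc _ (c k))

length-block : ∀ W c k → length (block W c k) ≡ c k
length-block W c k = trans (cong length (block≡progression W c k)) (length-applyUpTo _ (c k))

take-block : ∀ W c k {x} → x ≤ c k → take x (block W c k) ≡ progression (W c k) (W c (suc k)) x
take-block W c k x≤cₖ = trans (cong (take _) (block≡progression W c k)) (take-applyUpTo _ x≤cₖ)

block-cong : ∀ a b {c c′} k → (∀ j → j ≤ k → c′ j ≡ c j) →
             block (convₛ a b) c′ k ≡ block (convₛ a b) c k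
block-cong a b {c} {c′} k agree = begin
    block W c′ k                                ≡⟨ block≡progression W c′ k ⟩
    progression (W c′ k) (W c′ (suc k)) (c′ k)  ≡⟨ cong₂ (λ u v → progression u v (c′ k))
                                                         (same k (n≤1+n k)) (same (suc k) ≤-refl) ⟩
    progression (W c k) (W c (suc k)) (c′ k)    ≡⟨ cong (progression (W c k) (W c (suc k))) (agree k ≤-refl) ⟩
    progression (W c k) (W c (suc k)) (c k)     ≡⟨ sym (block≡progression W c k) ⟩
    block W c k                                 ∎
  where
  open ≡-Reasoning
  W : (ℕ → ℕ) → ℕ → ℕ
  W = convₛ a b
  same : ∀ i → i ≤ suc k → W c′ i ≡ W c i
  same = convₛ-cong a b k (λ j j<k → agree j (<⇒≤ j<k))

blocks-suc : ∀ W c k → blocks W c (suc k) ≡ blocks W c k ++ block W c k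
blocks-suc W c k = begin
    concatMap (block W c) (upTo (suc k))      ≡⟨ cong (concatMap (block W c)) (sym (upTo-∷ʳ k)) ⟩
    concatMap (block W c) (upTo k ++ k ∷ [])  ≡⟨ concatMap-++ (block W c) (upTo k) (k ∷ []) ⟩
    blocks W c k ++ (block W c k ++ [])       ≡⟨ cong (blocks W c k ++_) (++-identityʳ (block W c k)) ⟩
    blocks W c k ++ block W c k               ∎
  where open ≡-Reasoning

blocks-cong : ∀ a b {c c′} k → (∀ j → j < k → c′ j ≡ c j) →
              blocks (convₛ a b) c′ k ≡ blocks (convₛ a b) c k
blocks-cong a b           zero    _     = refl
blocks-cong a b {c} {c′} (suc k) agree = begin
    blocks W c′ (suc k)            ≡⟨ blocks-suc W c′ k ⟩
    blocks W c′ k ++ block W c′ k  ≡⟨ cong₂ _++_ (blocks-cong a b k (λ j j<k → agree j (m<n⇒m<1+n j<k)))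
                                                 (block-cong a b k (λ j j≤k → agree j (s≤s j≤k))) ⟩
    blocks W c k ++ block W c k    ≡⟨ sym (blocks-suc W c k) ⟩
    blocks W c (suc k)             ∎
  where
  open ≡-Reasoning
  W : (ℕ → ℕ) → ℕ → ℕ
  W = convₛ a b

length-blocks : ∀ W c k → length (blocks W c k) ≡ T c k
length-blocks W c zero    = refl
length-blocks W c (suc k) = begin
    length (blocks W c (suc k))                   ≡⟨ cong length (blocks-suc W c k) ⟩
    length (blocks W c k ++ block W c k)          ≡⟨ length-++ (blocks W c k) ⟩
    length (blocks W c k) + length (block W c k)  ≡⟨ cong₂ _+_ (length-blocks W c k) (length-block W c k) ⟩
    T c k + c k                                   ∎
  where open ≡-Reasoning

blocks-prefix : ∀ W c {k K} → k ≤′ K → ∃[ rest ] blocks W c K ≡ blocks W c k ++ rest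
blocks-prefix W c ≤′-refl = [] , sym (++-identityʳ _)
blocks-prefix W c {k} (≤′-step {K} k≤K) with blocks-prefix W c k≤K
... | rest , split = rest ++ block W c K , (begin
    blocks W c (suc K)                     ≡⟨ blocks-suc W c K ⟩
    blocks W c K ++ block W c K            ≡⟨ cong (_++ block W c K) split ⟩
    (blocks W c k ++ rest) ++ block W c K  ≡⟨ ++-assoc (blocks W c k) rest (block W c K) ⟩
    blocks W c k ++ (rest ++ block W c K)  ∎)
  where open ≡-Reasoning

take-blocks : ∀ W c {k K x} → k < K → x ≤ c k →
              take (T c k + x) (blocks W c K) ≡ blocks W c k ++ take x (block W c k)
take-blocks W c {k} {K} {x} k<K x≤cₖ with blocks-prefix W c (≤⇒≤′ k<K)
... | rest , split = begin
    take (T c k + x) (blocks W c K)            ≡⟨ cong (take (T c k + x)) blocks≡ ⟩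
    take (T c k + x) (Bₖ ++ (bₖ ++ rest))      ≡⟨ cong (λ t → take (t + x) (Bₖ ++ (bₖ ++ rest)))
                                                       (sym (length-blocks W c k)) ⟩
    take (length Bₖ + x) (Bₖ ++ (bₖ ++ rest))  ≡⟨ take-length-++ Bₖ (bₖ ++ rest) x ⟩
    Bₖ ++ take x (bₖ ++ rest)                  ≡⟨ cong (Bₖ ++_) (take-++-≤ bₖ rest x≤length) ⟩
    Bₖ ++ take x bₖ                            ∎
  where
  open ≡-Reasoning
  Bₖ bₖ : List ℕ
  Bₖ = blocks W c k
  bₖ = block W c k
  blocks≡ : blocks W c K ≡ Bₖ ++ (bₖ ++ rest)
  blocks≡ = trans split (trans (cong (_++ rest) (blocks-suc W c k)) (++-assoc Bₖ bₖ rest))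
  x≤length : x ≤ length bₖ
  x≤length = subst (x ≤_) (sym (length-block W c k)) x≤cₖ

take-lengthsGen : ∀ a b {n′ c′ n c} → Truncation 1 n′ c′ n c →
                  take (T c′ n′ + (c′ n′ ∸ 1)) (lengthsGen (convₛ a b) n′ c′)
                    ≡ take (T c′ n′ + (c′ n′ ∸ 1)) (lengthsGen (convₛ a b) n c)
take-lengthsGen a b {n′} {c′} {n} {c} tr = begin
    take (T c′ n′ + x) (blocks W c′ (suc n′))  ≡⟨ take-blocks W c′ ≤-refl x≤c′ ⟩
    blocks W c′ n′ ++ take x (block W c′ n′)   ≡⟨ cong₂ _++_ same-blocks same-progression ⟩
    blocks W c n′ ++ take x (block W c n′)     ≡⟨ sym (take-blocks W c (s≤s length≤) x≤c) ⟩
    take (T c n′ + x) (blocks W c (suc n))     ≡⟨ cong (λ t → take (t + x) (blocks W c (suc n))) (sym same-T) ⟩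
    take (T c′ n′ + x) (blocks W c (suc n))    ∎
  where
  open ≡-Reasoning
  open Truncation tr
  W : (ℕ → ℕ) → ℕ → ℕ
  W = convₛ a b
  x : ℕ
  x = c′ n′ ∸ 1
  x≤c′ : x ≤ c′ n′
  x≤c′ = m∸n≤m (c′ n′) 1
  x≤c : x ≤ c n′
  x≤c = ∸-monoˡ-≤ 1 last≤
  same : ∀ i → i ≤ suc n′ → W c′ i ≡ W c i
  same = convₛ-cong a b n′ agree
  same-blocks : blocks W c′ n′ ≡ blocks W c n′
  same-blocks = blocks-cong a b n′ agree
  same-T : T c′ n′ ≡ T c n′
  same-T = trans (sym (length-blocks W c′ n′)) (trans (cong length same-blocks) (length-blocks W c n′))
  same-progression : take x (block W c′ n′) ≡ take x (block W c n′)
  same-progression = begin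
    take x (block W c′ n′)                   ≡⟨ take-block W c′ n′ x≤c′ ⟩
    progression (W c′ n′) (W c′ (suc n′)) x  ≡⟨ cong₂ (λ u v → progression u v x)
                                                      (same n′ (n≤1+n n′)) (same (suc n′) ≤-refl) ⟩
    progression (W c n′) (W c (suc n′)) x    ≡⟨ sym (take-block W c n′ x≤c) ⟩
    take x (block W c n′)                    ∎

rank+1 : ∀ n c → 2 ≤ c n → rank n c + 1 ≡ T c n + (c n ∸ 1)
rank+1 n c 2≤cₙ = begin
    T c n + c n ∸ 2 + 1    ≡⟨ +-comm (T c n + c n ∸ 2) 1 ⟩
    1 + (T c n + c n ∸ 2)  ≡⟨ sym (+-∸-assoc 1 (≤-trans 2≤cₙ (m≤n+m (c n) (T c n)))) ⟩
    T c n + c n ∸ 1        ≡⟨ +-∸-assoc (T c n) (<⇒≤ 2≤cₙ) ⟩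
    T c n + (c n ∸ 1)      ∎
  where open ≡-Reasoning

record TruncatedExpansion (q′ q n : ℕ) (c : ℕ → ℕ) : Set where
  field
    m          : ℕ
    e          : ℕ → ℕ
    positive   : Positive (suc m) e
    truncation : Truncation 0 m e n c
    value      : HasValue q′ q m e

rank-prefix : ∀ a b {q′ q n c n′ c′} → TruncatedExpansion q′ q n c → IsCF q′ q n′ c′ →
              take (rank n′ c′ + 1) (lengthsGen (convₛ a b) n′ c′)
                ≡ take (rank n′ c′ + 1) (lengthsGen (convₛ a b) n c)
rank-prefix a b {n = n} {c} {n′} {c′} te (can′ , value′) =
  subst (λ r → take r (lengthsGen (convₛ a b) n′ c′) ≡ take r (lengthsGen (convₛ a b) n c))
        (sym (rank+1 n′ c′ (proj₂ can′)))
        (take-lengthsGen a b (truncation-trans canonical truncation))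
  where
  open TruncatedExpansion te
  canonical : Truncation 1 n′ c′ m e
  canonical = canonical⇒truncation m n′ positive can′ value value′

-- Increments of ξ

data Parity : ℕ → Set where
  even : ∀ k → Parity (k * 2)
  odd  : ∀ k → Parity (suc (k * 2))

parity : ∀ ℓ → Parity ℓ
parity zero          = even 0
parity (suc zero)    = odd 0
parity (suc (suc ℓ)) with parity ℓ
... | even k = even (suc k)
... | odd  k = odd (suc k)

even%2 : ∀ k → (k * 2) % 2 ≡ 0
even%2 k = m*n%n≡0 k 2

odd%2 : ∀ k → suc (k * 2) % 2 ≡ 1
odd%2 k = [m+kn]%n≡m%n 1 k 2

odd≢even : ∀ j k → suc (j * 2) ≢ k * 2
odd≢even j k eq = 1+n≢0 (trans (sym (odd%2 j)) (trans (cong (_% 2) eq) (even%2 k)))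

odd⊎end⊎inner : ∀ K {ℓ} → ℓ ≤ K * 2 →
                ℓ % 2 ≡ 1 ⊎ (ℓ ≡ 0 ⊎ ℓ ≡ K * 2) ⊎ (ℓ % 2 ≡ 0 × 0 < ℓ × ℓ < K * 2)
odd⊎end⊎inner K {ℓ} ℓ≤ with parity ℓ
... | odd k        = inj₁ (odd%2 k)
... | even zero    = inj₂ (inj₁ (inj₁ refl))
... | even (suc k) with m≤n⇒m<n∨m≡n ℓ≤
...   | inj₁ ℓ< = inj₂ (inj₂ (even%2 (suc k) , z<s , ℓ<))
...   | inj₂ ℓ≡ = inj₂ (inj₁ (inj₂ ℓ≡))

xiAux-odd : ∀ a b k → xiAux a b (suc (k * 2)) ≡ suc k * a
xiAux-odd a b zero    = sym (+-identityʳ a)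
xiAux-odd a b (suc k) = cong (a +_) (xiAux-odd a b k)

xiAux-even : ∀ a b k → xiAux a b (suc (suc (k * 2))) ≡ suc k * a + b
xiAux-even a b zero    = cong (_+ b) (sym (+-identityʳ a))
xiAux-even a b (suc k) = trans (cong (a +_) (xiAux-even a b k)) (sym (+-assoc a (suc k * a) b))

-- G is ξ on 0, …, 2K + 1 when c_n = K + 1: the top value is p' = c_n y_n + y_{n-1}.
module Increments (a b K : ℕ) (G : ℕ → ℕ)
                  (G-top  : G (suc (K * 2)) ≡ suc K * a + b)
                  (G-rest : ∀ i → i ≢ suc (K * 2) → G i ≡ xiAux a b i) where

  open ≡-Reasoning

  Δ : ℕ → ℕ
  Δ ℓ = G (suc ℓ) ∸ G ℓ

  Δ-odd : ∀ {ℓ} → ℓ % 2 ≡ 1 → ℓ < suc (K * 2) → Δ ℓ ≡ b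
  Δ-odd {ℓ} ℓ-odd ℓ< with parity ℓ
  ... | even k = contradiction (trans (sym ℓ-odd) (even%2 k)) 1+n≢0
  ... | odd  k = begin
      G (suc (suc (k * 2))) ∸ G (suc (k * 2))
    ≡⟨ cong₂ _∸_ (G-rest _ (odd≢even k K ∘ suc-injective)) (G-rest _ (<⇒≢ ℓ<)) ⟩
      xiAux a b (suc (suc (k * 2))) ∸ xiAux a b (suc (k * 2))
    ≡⟨ cong₂ _∸_ (xiAux-even a b k) (xiAux-odd a b k) ⟩
      suc k * a + b ∸ suc k * a
    ≡⟨ m+n∸m≡n (suc k * a) b ⟩
      b
    ∎

  Δ-end : ∀ {ℓ} → 0 < K → ℓ ≡ 0 ⊎ ℓ ≡ K * 2 → Δ ℓ ≡ a
  Δ-end 0<K (inj₁ refl) = cong₂ _∸_ (G-rest 1 (<⇒≢ (s<s (*-monoˡ-< 2 0<K)))) (G-rest 0 λ ())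
  Δ-end (s≤s {n = K′} z≤n) (inj₂ refl) = begin
      G (suc (suc (suc (K′ * 2)))) ∸ G (suc (suc (K′ * 2)))
    ≡⟨ cong₂ _∸_ G-top (G-rest _ (<⇒≢ (n<1+n _))) ⟩
      suc (suc K′) * a + b ∸ xiAux a b (suc (suc (K′ * 2)))
    ≡⟨ cong₂ _∸_ (+-assoc a (suc K′ * a) b) (xiAux-even a b K′) ⟩
      a + (suc K′ * a + b) ∸ (suc K′ * a + b)
    ≡⟨ m+n∸n≡m a (suc K′ * a + b) ⟩
      a
    ∎

  Δ-inner : ∀ {ℓ} → ℓ % 2 ≡ 0 → 0 < ℓ → ℓ < K * 2 → Δ ℓ ≡ a ∸ b
  Δ-inner {ℓ} ℓ-even 0<ℓ ℓ< with parity ℓ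
  ... | odd  k       = contradiction (trans (sym (odd%2 k)) ℓ-even) 1+n≢0
  ... | even zero    = contradiction 0<ℓ (n≮n 0)
  ... | even (suc k) = begin
      G (suc (suc (suc (k * 2)))) ∸ G (suc (suc (k * 2)))
    ≡⟨ cong₂ _∸_ (G-rest _ (<⇒≢ (s<s ℓ<))) (G-rest _ (λ eq → odd≢even K (suc k) (sym eq))) ⟩
      xiAux a b (suc (suc k * 2)) ∸ xiAux a b (suc k * 2)
    ≡⟨ cong₂ _∸_ (xiAux-odd a b (suc k)) (xiAux-even a b k) ⟩
      a + suc k * a ∸ (suc k * a + b)
    ≡⟨ cong (_∸ (suc k * a + b)) (+-comm a (suc k * a)) ⟩
      suc k * a + a ∸ (suc k * a + b)
    ≡⟨ [m+n]∸[m+o]≡n∸o (suc k * a) a b ⟩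
      a ∸ b
    ∎

-- Ξ 0 1 n c and Ξ 1 0 n c are ξ n c p' and ξ~ n c p for p' = y_{n+1} and p = z_{n+1}.
Ξ : ℕ → ℕ → ℕ → (ℕ → ℕ) → ℕ → ℕ
Ξ a b n c i = if does (i ≟ 2 * c n ∸ 1) then convₛ a b c (suc (suc n))
              else xiAux (convₛ a b c (suc n)) (convₛ a b c n) i

ΔΞ : ℕ → ℕ → ℕ → (ℕ → ℕ) → ℕ → ℕ
ΔΞ a b n c ℓ = Ξ a b n c (ℓ + 1) ∸ Ξ a b n c ℓ

module _ (n : ℕ) (c : ℕ → ℕ) (2≤cₙ : 2 ≤ c n) where

  private
    K : ℕ
    K = c n ∸ 1

    cₙ≡1+K : c n ≡ suc K
    cₙ≡1+K = sym (m+[n∸m]≡n (<⇒≤ 2≤cₙ))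

    2cₙ≡ : 2 * c n ≡ suc (suc (K * 2))
    2cₙ≡ = trans (*-comm 2 (c n)) (cong (_* 2) cₙ≡1+K)

    top≡ : 2 * c n ∸ 1 ≡ suc (K * 2)
    top≡ = cong (_∸ 1) 2cₙ≡

    end≡ : 2 * c n ∸ 2 ≡ K * 2
    end≡ = cong (_∸ 2) 2cₙ≡

  ℓ-shape : ∀ {ℓ} → ℓ < 2 * c n ∸ 1 →
            ℓ % 2 ≡ 1 ⊎ (ℓ ≡ 0 ⊎ ℓ ≡ 2 * c n ∸ 2) ⊎ (ℓ % 2 ≡ 0 × 0 < ℓ × ℓ < 2 * c n ∸ 2)
  ℓ-shape ℓ< rewrite 2cₙ≡ = odd⊎end⊎inner K (s≤s⁻¹ ℓ<)

  module _ (a b : ℕ) where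

    private
      Ξ-top : Ξ a b n c (suc (K * 2)) ≡ suc K * convₛ a b c (suc n) + convₛ a b c n
      Ξ-top = trans (if-≟-≡ _ _ (sym top≡))
                    (cong (λ x → x * convₛ a b c (suc n) + convₛ a b c n) cₙ≡1+K)

      Ξ-rest : ∀ i → i ≢ suc (K * 2) →
               Ξ a b n c i ≡ xiAux (convₛ a b c (suc n)) (convₛ a b c n) i
      Ξ-rest i i≢ = if-≟-≢ _ _ (λ eq → i≢ (trans eq top≡))

      open Increments (convₛ a b c (suc n)) (convₛ a b c n) K (Ξ a b n c) Ξ-top Ξ-rest

      ΔΞ≡Δ : ∀ ℓ → ΔΞ a b n c ℓ ≡ Δ ℓ
      ΔΞ≡Δ ℓ = cong (λ i → Ξ a b n c i ∸ Ξ a b n c ℓ) (+-comm ℓ 1)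

    ΔΞ-odd : ∀ {ℓ} → ℓ % 2 ≡ 1 → ℓ < 2 * c n ∸ 1 → ΔΞ a b n c ℓ ≡ convₛ a b c n
    ΔΞ-odd {ℓ} ℓ-odd ℓ< = trans (ΔΞ≡Δ ℓ) (Δ-odd ℓ-odd (subst (ℓ <_) top≡ ℓ<))

    ΔΞ-end : ∀ {ℓ} → ℓ ≡ 0 ⊎ ℓ ≡ 2 * c n ∸ 2 → ΔΞ a b n c ℓ ≡ convₛ a b c (suc n)
    ΔΞ-end {ℓ} ℓ-end =
      trans (ΔΞ≡Δ ℓ) (Δ-end (∸-monoˡ-≤ 1 2≤cₙ) (⊎-map₂ (λ eq → trans eq end≡) ℓ-end))

    ΔΞ-inner : ∀ {ℓ} → ℓ % 2 ≡ 0 → 0 < ℓ → ℓ < 2 * c n ∸ 2 →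
               ΔΞ a b n c ℓ ≡ convₛ a b c (suc n) ∸ convₛ a b c n
    ΔΞ-inner {ℓ} ℓ-even 0<ℓ ℓ< = trans (ΔΞ≡Δ ℓ) (Δ-inner ℓ-even 0<ℓ (subst (ℓ <_) end≡ ℓ<))

CaseI CaseII CaseIII CaseIV Cases : ℕ → (ℕ → ℕ) → ℕ → Set
CaseI   n c ℓ = ℓ % 2 ≡ 1 × Cond₁ n c
CaseII  n c ℓ = (ℓ ≡ 0 ⊎ ℓ ≡ 2 * c n ∸ 2) × Cond₂ n c
CaseIII n c ℓ = ℓ % 2 ≡ 0 × 0 < ℓ × ℓ < 2 * c n ∸ 2 × Cond₃ n c
CaseIV  n c ℓ = ℓ % 2 ≡ 0 × 0 < ℓ × ℓ < 2 * c n ∸ 2 × Cond₄ n c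
Cases   n c ℓ = CaseI n c ℓ ⊎ CaseII n c ℓ ⊎ CaseIII n c ℓ ⊎ CaseIV n c ℓ

2≤ΔΞ⇔Cases : ∀ {n c ℓ} → Canonical n c → ℓ < 2 * c n ∸ 1 → 2 ≤ ΔΞ 0 1 n c ℓ ⇔ Cases n c ℓ
2≤ΔΞ⇔Cases {n} {c} {ℓ} (pos , 2≤cₙ) ℓ< = mk⇔ ⇒Cases Cases⇒
  where
  open Equivalence
  Cond₁⇔ : 2 ≤ Yₛ c n ⇔ Cond₁ n c
  Cond₁⇔ = 2≤Yₛ⇔Cond₁ (Positive-≤ (m∸n≤m n 1) pos)

  ⇒Cases : 2 ≤ ΔΞ 0 1 n c ℓ → Cases n c ℓ
  ⇒Cases 2≤ with ℓ-shape n c 2≤cₙ ℓ<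
  ... | inj₁ ℓ-odd =
    inj₁ (ℓ-odd , to Cond₁⇔ (subst (2 ≤_) (ΔΞ-odd n c 2≤cₙ 0 1 ℓ-odd ℓ<) 2≤))
  ... | inj₂ (inj₁ ℓ-end) =
    inj₂ (inj₁ (ℓ-end , to (2≤y⇔Cond₂ pos) (subst (2 ≤_) (ΔΞ-end n c 2≤cₙ 0 1 ℓ-end) 2≤)))
  ... | inj₂ (inj₂ (ℓ-even , 0<ℓ , ℓ<′)) =
    inj₂ (inj₂ (⊎-map (λ h → ℓ-even , 0<ℓ , ℓ<′ , h) (λ h → ℓ-even , 0<ℓ , ℓ<′ , h)
                      (to (2≤y∸Yₛ⇔Cond₃⊎Cond₄ pos)
                          (subst (2 ≤_) (ΔΞ-inner n c 2≤cₙ 0 1 ℓ-even 0<ℓ ℓ<′) 2≤))))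

  Cases⇒ : Cases n c ℓ → 2 ≤ ΔΞ 0 1 n c ℓ
  Cases⇒ (inj₁ (ℓ-odd , h)) =
    subst (2 ≤_) (sym (ΔΞ-odd n c 2≤cₙ 0 1 ℓ-odd ℓ<)) (from Cond₁⇔ h)
  Cases⇒ (inj₂ (inj₁ (ℓ-end , h))) =
    subst (2 ≤_) (sym (ΔΞ-end n c 2≤cₙ 0 1 ℓ-end)) (from (2≤y⇔Cond₂ pos) h)
  Cases⇒ (inj₂ (inj₂ (inj₁ (ℓ-even , 0<ℓ , ℓ<′ , h)))) =
    subst (2 ≤_) (sym (ΔΞ-inner n c 2≤cₙ 0 1 ℓ-even 0<ℓ ℓ<′))
                 (from (2≤y∸Yₛ⇔Cond₃⊎Cond₄ pos) (inj₁ h))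
  Cases⇒ (inj₂ (inj₂ (inj₂ (ℓ-even , 0<ℓ , ℓ<′ , h)))) =
    subst (2 ≤_) (sym (ΔΞ-inner n c 2≤cₙ 0 1 ℓ-even 0<ℓ ℓ<′))
                 (from (2≤y∸Yₛ⇔Cond₃⊎Cond₄ pos) (inj₂ h))

-- y = convₛ 0 1 and z = convₛ 1 0, so one identity for all initial values gives both.
hasValue : ∀ n c ℓ m e → (∀ a b → convₛ a b e (suc (suc m)) ≡ ΔΞ a b n c ℓ) →
           HasValue (ΔΞ 0 1 n c ℓ) (ΔΞ 1 0 n c ℓ) m e
hasValue _ _ _ _ _ same = same 0 1 , same 1 0

value-i : ∀ {n c ℓ} → Canonical n c → ℓ < 2 * c n ∸ 1 → CaseI n c ℓ →
          HasValue (ΔΞ 0 1 n c ℓ) (ΔΞ 1 0 n c ℓ) (n ∸ 2) c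
value-i {n} {c} {ℓ} (_ , 2≤cₙ) ℓ< (ℓ-odd , s≤s (s≤s _) , _) =
  hasValue n c ℓ (n ∸ 2) c λ a b → sym (ΔΞ-odd n c 2≤cₙ a b ℓ-odd ℓ<)

value-ii : ∀ {n c ℓ} → Canonical n c → CaseII n c ℓ →
           HasValue (ΔΞ 0 1 n c ℓ) (ΔΞ 1 0 n c ℓ) (n ∸ 1) c
value-ii {n} {c} {ℓ} (_ , 2≤cₙ) (ℓ-end , s≤s _ , _) =
  hasValue n c ℓ (n ∸ 1) c λ a b → sym (ΔΞ-end n c 2≤cₙ a b ℓ-end)

value-iii : ∀ {n c ℓ} → Canonical n c → CaseIII n c ℓ →
            HasValue (ΔΞ 0 1 n c ℓ) (ΔΞ 1 0 n c ℓ) (n ∸ 1) (decAt (n ∸ 1) c)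
value-iii {n} {c} {ℓ} (_ , 2≤cₙ) (ℓ-even , 0<ℓ , ℓ< , 1<cₘ , s≤s _ , _) =
  hasValue n c ℓ (n ∸ 1) (decAt (n ∸ 1) c) λ a b →
    trans (convₛ-decAt a b c (n ∸ 1) (<⇒≤ 1<cₘ)) (sym (ΔΞ-inner n c 2≤cₙ a b ℓ-even 0<ℓ ℓ<))

value-iv : ∀ {n c ℓ} → Canonical n c → CaseIV n c ℓ →
           HasValue (ΔΞ 0 1 n c ℓ) (ΔΞ 1 0 n c ℓ) (n ∸ 3) c
value-iv {n} {c} {ℓ} (_ , 2≤cₙ) (ℓ-even , 0<ℓ , ℓ< , cₘ≡1 , s≤s (s≤s (s≤s _)) , _) =
  hasValue n c ℓ (n ∸ 3) c λ a b →
    trans (sym (convₛ-step-unit a b c (n ∸ 1) cₘ≡1)) (sym (ΔΞ-inner n c 2≤cₙ a b ℓ-even 0<ℓ ℓ<))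

truncated-expansion : ∀ {q′ q n c} k → Canonical n c → HasValue q′ q (n ∸ k) c →
                      TruncatedExpansion q′ q n c
truncated-expansion {n = n} {c} k can value = record
  { m          = n ∸ k
  ; e          = c
  ; positive   = Positive-≤ (s≤s (m∸n≤m n k)) (canonical⇒positive can)
  ; truncation = truncation-refl (m∸n≤m n k)
  ; value      = value
  }

expansion : ∀ {n c ℓ} → Canonical n c → ℓ < 2 * c n ∸ 1 → Cases n c ℓ →
            TruncatedExpansion (ΔΞ 0 1 n c ℓ) (ΔΞ 1 0 n c ℓ) n c
expansion can ℓ< (inj₁ h)                  = truncated-expansion 2 can (value-i can ℓ< h)
expansion can _  (inj₂ (inj₁ h))           = truncated-expansion 1 can (value-ii can h)
expansion can _  (inj₂ (inj₂ (inj₂ h)))    = truncated-expansion 3 can (value-iv can h)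
expansion {n} {c} can _ (inj₂ (inj₂ (inj₁ h@(_ , _ , _ , 1<cₘ , _)))) = record
  { m          = n ∸ 1
  ; e          = decAt (n ∸ 1) c
  ; positive   = Positive-decAt (Positive-≤ (m∸n≤m n 1) (proj₁ can)) 1<cₘ
  ; truncation = truncation-decAt (m∸n≤m n 1)
  ; value      = value-iii can h
  }

lemmaE9 : (p p' : ℕ) → Coprime p p' → 1 ≤ p → p < p' →
          (n : ℕ) (c : ℕ → ℕ) → IsCF p' p n c →
          (ℓ : ℕ) → ℓ < 2 * c n ∸ 1 →
          let p̂' = ξ n c p' (ℓ + 1) ∸ ξ n c p' ℓ
              p̂  = ξ~ n c p (ℓ + 1) ∸ ξ~ n c p ℓ
              condi = ℓ % 2 ≡ 1 × 2 ≤ n × (n ≡ 2 → c 0 > 1)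
              condii = (ℓ ≡ 0 ⊎ ℓ ≡ 2 * c n ∸ 2) × 1 ≤ n × (n ≡ 1 → c 0 > 1)
              condiii = ℓ % 2 ≡ 0 × 0 < ℓ × ℓ < 2 * c n ∸ 2 × c (n ∸ 1) > 1
                        × 1 ≤ n × (n ≡ 1 → c 0 > 2)
              condiv = ℓ % 2 ≡ 0 × 0 < ℓ × ℓ < 2 * c n ∸ 2 × c (n ∸ 1) ≡ 1
                       × 3 ≤ n × (n ≡ 3 → c 0 > 1)
          in
          -- part (1)
          ((2 ≤ p̂' ⇔ (condi ⊎ condii ⊎ condiii ⊎ condiv))
           × (condi → HasValue p̂' p̂ (n ∸ 2) c)
           × (condii → HasValue p̂' p̂ (n ∸ 1) c)
           × (condiii → HasValue p̂' p̂ (n ∸ 1) (decAt (n ∸ 1) c))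
           × (condiv → HasValue p̂' p̂ (n ∸ 3) c))
          ×
          -- part (2)
          (2 ≤ p̂' → (n' : ℕ) (c' : ℕ → ℕ) → IsCF p̂' p̂ n' c' →
            (take (rank n' c' + 1) (takahashi n' c')
               ≡ take (rank n' c' + 1) (takahashi n c))
            × (take (rank n' c' + 1) (truncTakahashi n' c')
               ≡ take (rank n' c' + 1) (truncTakahashi n c)))
lemmaE9 _ _ _ _ _ n c (can , refl , refl) ℓ ℓ< =
  (2≤ΔΞ⇔Cases can ℓ< , value-i can ℓ< , value-ii can , value-iii can , value-iv can) ,
  λ 2≤p̂′ n′ c′ cf′ →
    let te = expansion can ℓ< (Equivalence.to (2≤ΔΞ⇔Cases can ℓ<) 2≤p̂′)
    in  rank-prefix 0 1 te cf′ , rank-prefix 1 0 te cf′
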